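{- Given a finite PTI net $N=(S,A,T,I)$, for each pair of markings $m_1,m_2\in\mathcal{M}(S)$ it is decidable whether $m_1\sim_p m_2$; i.e., there is an algorithm that, given $N$, $m_1$ and $m_2$, decides whether $m_1$ and $m_2$ are pti-place bisimilar.
   Context: Multisets over a finite set $S$ are functions $m:S\to\mathbb{N}$; $\mathcal{M}(S)$ is their set, $\theta$ the empty multiset, $\subseteq$ pointwise order, $\oplus$ pointwise sum, $(m\ominus m')(s)=\max\{m(s)-m'(s),0\}$, $\mathit{dom}(m)=\{s\mid m(s)\ne0\}$; a place $s$ also denotes the singleton multiset. A finite PTI net is $N=(S,A,T,I)$ with finite places $S$, finite labels $A$, finite transitions $T\subseteq(\mathcal{M}(S)\setminus\{\theta\})\times A\times(\mathcal{M}(S)\setminus\{\theta\})$ and inhibiting relation $I\subseteq S\times T$. For $t=(m,\ell,m')$: ${}^\bullet t=m$, $l(t)=\ell$, $t^\bullet=m'$, ${}^\circ t=\{s\mid(s,t)\in I\}$. $t$ is enabled at marking $m$ if ${}^\bullet t\subseteq m$ and ${}^\circ t\cap\mathit{dom}(m)=\emptyset$, and then $m[t\rangle m'$ with $m'=(m\ominus{}^\bullet t)\oplus t^\bullet$. For $R\subseteq S\times S$, $R^\oplus$ is the least relation on $\mathcal{M}(S)$ with $(\theta,\theta)\in R^\oplus$ and $(s_1\oplus m_1,s_2\oplus m_2)\in R^\oplus$ whenever $(s_1,s_2)\in R$ and $(m_1,m_2)\in R^\oplus$. $R$ is a pti-place bisimulation if whenever $(m_1,m_2)\in R^\oplus$: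 (1) for every $t_1$ with $m_1[t_1\rangle m_1'$ there is $t_2$ with $m_2[t_2\rangle m_2'$ such that (a) $({}^\bullet t_1,{}^\bullet t_2)\in R^\oplus$, $(t_1^\bullet,t_2^\bullet)\in R^\oplus$, $l(t_1)=l(t_2)$, $(m_1\ominus{}^\bullet t_1,m_2\ominus{}^\bullet t_2)\in R^\oplus$, and (b) for all $(s,s')\in R$, $s\in{}^\circ t_1\iff s'\in{}^\circ t_2$; (2) symmetrically, for every $t_2$ with $m_2[t_2\rangle m_2'$ there is $t_1$ with $m_1[t_1\rangle m_1'$ satisfying (a) and (b). Markings are pti-place bisimilar, $m_1\sim_p m_2$, if there exists a pti-place bisimulation $R$ with $(m_1,m_2)\in R^\oplus$. -}

module Defs where

open import Data.Nat using (ℕ; _≤_; _+_; _∸_)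
open import Data.Fin using (Fin; _≟_)
open import Data.Bool using (Bool; true; if_then_else_)
open import Data.Vec using (Vec; replicate; zipWith; tabulate; lookup)
open import Data.Vec.Relation.Binary.Pointwise.Inductive using (Pointwise)
open import Data.Product using (Σ; _×_; ∃)
open import Relation.Nullary using (¬_)
open import Relation.Nullary.Decidable using (⌊_⌋)
open import Relation.Binary.PropositionalEquality using (_≡_; _≢_)

-- Places are S = Fin n; multisets over S are vectors of multiplicities
Multiset : ℕ → Set
Multiset n = Vec ℕ n

module _ {n : ℕ} where

  θ : Multiset n
  θ = replicate n 0

  sing : Fin n → Multiset n
  sing s = tabulate (λ j → if ⌊ s ≟ j ⌋ then 1 else 0)

  infixl 6 _⊕_ _⊖_
  _⊕_ : Multiset n → Multiset n → Multiset n
  _⊕_ = zipWith _+_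

  _⊖_ : Multiset n → Multiset n → Multiset n
  _⊖_ = zipWith _∸_

  infix 4 _⊆_
  _⊆_ : Multiset n → Multiset n → Set
  _⊆_ = Pointwise _≤_

  InDom : Fin n → Multiset n → Set
  InDom s m = lookup m s ≢ 0

-- A finite PTI net with places Fin n, labels Fin k, transitions Fin t
-- (T is a set of triples: the triple map is injective),
-- and inhibiting relation I ⊆ S × T given as a decidable (Bool) relation.
record PTINet (n k : ℕ) : Set where
  field
    t      : ℕ
    pre    : Fin t → Multiset n
    lab    : Fin t → Fin k
    post   : Fin t → Multiset n
    pre≢θ  : ∀ i → pre i ≢ θ
    post≢θ : ∀ i → post i ≢ θ
    inh    : Fin n → Fin t → Bool
    distinct : ∀ i j → pre i ≡ pre j → lab i ≡ lab j → post i ≡ post j → i ≡ j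

PlaceRel : ℕ → Set
PlaceRel n = Fin n → Fin n → Bool

data Lift {n : ℕ} (R : PlaceRel n) : Multiset n → Multiset n → Set where
  θθ   : Lift R θ θ
  step : ∀ {s₁ s₂ m₁ m₂} → R s₁ s₂ ≡ true → Lift R m₁ m₂ →
         Lift R (sing s₁ ⊕ m₁) (sing s₂ ⊕ m₂)

module _ {n k : ℕ} (N : PTINet n k) where
  open PTINet N

  Enabled : Fin t → Multiset n → Set
  Enabled i m = (pre i ⊆ m) × (∀ s → inh s i ≡ true → ¬ InDom s m)

  Match : PlaceRel n → Multiset n → Multiset n → Fin t → Fin t → Set
  Match R m₁ m₂ t₁ t₂ =
      (Lift R (pre t₁) (pre t₂) × Lift R (post t₁) (post t₂) × lab t₁ ≡ lab t₂
        × Lift R (m₁ ⊖ pre t₁) (m₂ ⊖ pre t₂))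
    × (∀ s s′ → R s s′ ≡ true →
         (inh s t₁ ≡ true → inh s′ t₂ ≡ true) × (inh s′ t₂ ≡ true → inh s t₁ ≡ true))

  IsPtiPlaceBisim : PlaceRel n → Set
  IsPtiPlaceBisim R = ∀ m₁ m₂ → Lift R m₁ m₂ →
      (∀ t₁ → Enabled t₁ m₁ → ∃ λ t₂ → Enabled t₂ m₂ × Match R m₁ m₂ t₁ t₂)
    × (∀ t₂ → Enabled t₂ m₂ → ∃ λ t₁ → Enabled t₁ m₁ × Match R m₁ m₂ t₁ t₂)

  PtiPlaceBisimilar : Multiset n → Multiset n → Set
  PtiPlaceBisimilar m₁ m₂ = Σ (PlaceRel n) λ R → IsPtiPlaceBisim R × Lift R m₁ m₂

-- Whether R is a pti-place bisimulation only depends on markings with at most n·K tokens on each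
-- place, where K ≥ 2 + every multiplicity occurring in a preset.  If a derivation of
-- (m₁ , m₂) ∈ R^⊕ uses some pair (a , b) ∈ R at least K times, then every preset leaves at least
-- two tokens on a in m₁ and on b in m₂; so removing one token of a from m₁ and one of b from m₂
-- changes neither which transitions are enabled (inhibitors only test emptiness) nor whether two
-- transitions match, and the transfer property of (m₁ , m₂) follows from that of the smaller
-- pair.  Otherwise every pair is used fewer than K times and both markings are bounded by n·K.
-- Membership in R^⊕ is decidable because any token of m₁ can be matched first, and there are
-- finitely many relations R.

module Submission where

open import Defs
open import Data.Nat using (ℕ; zero; suc; _+_; _*_; _∸_; _≤_; _<_; z≤n; s≤s; _≤?_; _<?_)
open import Data.Nat.Properties
open import Data.Nat.Induction using (<-wellFounded)
open import Data.Fin using (Fin; zero; suc; toℕ; fromℕ<; punchIn) renaming (_≟_ to _≟ᶠ_)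
open import Data.Fin.Properties using (any?; all?; toℕ-fromℕ<; toℕ≤pred[n]; punchInᵢ≢i)
open import Data.Bool using (Bool; true; false; if_then_else_) renaming (_≟_ to _≟ᵇ_)
open import Data.Vec using (Vec; []; _∷_; lookup; tabulate; map)
open import Data.Vec.Properties
  using (lookup-zipWith; lookup-replicate; lookup∘tabulate; tabulate∘lookup; tabulate-cong; lookup-map; ≡-dec)
import Data.Vec.Relation.Binary.Pointwise.Inductive as Pointwise
open import Data.Product using (∃; ∃₂; _×_; _,_; proj₁)
open import Data.Sum using (_⊎_; inj₁; inj₂; [_,_])
open import Function using (_∘_)
open import Induction.WellFounded using (Acc; acc)
open import Relation.Nullary using (Dec; does; yes; no; ¬_; ¬?; contradiction)
open import Relation.Nullary.Decidable
  using (map′; _×-dec_; _→-dec_; _⊎-dec_; decidable-stable; dec-true; dec-false; isYes≗does)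
open import Relation.Unary using (Decidable)
open import Relation.Binary.PropositionalEquality
  using (_≡_; _≢_; refl; sym; trans; cong; cong₂; subst; subst₂; _≗_; module ≡-Reasoning)
open import Algebra.Properties.Semiring.Sum +-*-semiring
  using (sum; sum-cong-≗; sum-remove; sum-replicate-zero; ∑-distrib-+; *-distribˡ-sum; *-distribʳ-sum)

Exhaustible : Set → Set₁
Exhaustible A = ∀ {P : A → Set} → Decidable P → Dec (∃ P)

∀? : ∀ {A} → Exhaustible A → ∀ {P : A → Set} → Decidable P → Dec (∀ a → P a)
∀? ∃? P? = map′ (λ ∄¬P a → decidable-stable (P? a) (λ ¬Pa → ∄¬P (a , ¬Pa)))
                (λ ∀P (a , ¬Pa) → ¬Pa (∀P a))
                (¬? (∃? (¬? ∘ P?)))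

exhaustible-Fin : ∀ {m} → Exhaustible (Fin m)
exhaustible-Fin = any?

exhaustible-Bool : Exhaustible Bool
exhaustible-Bool P? =
  map′ [ (true ,_) , (false ,_) ] (λ { (true , p) → inj₁ p ; (false , p) → inj₂ p })
       (P? true ⊎-dec P? false)

exhaustible-Vec : ∀ {A} → Exhaustible A → ∀ n → Exhaustible (Vec A n)
exhaustible-Vec ∃? zero    P? = map′ ([] ,_) (λ { ([] , p) → p }) (P? [])
exhaustible-Vec ∃? (suc n) P? =
  map′ (λ (x , xs , p) → x ∷ xs , p) (λ { (x ∷ xs , p) → x , xs , p })
       (∃? (λ x → exhaustible-Vec ∃? n (P? ∘ (x ∷_))))

≤-sum : ∀ {n} (f : Fin n → ℕ) i → f i ≤ sum f
≤-sum {suc n} f i = subst (f i ≤_) (sym (sum-remove {i = i} f)) (m≤m+n (f i) _)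

sum-≤-* : ∀ {n} c (f : Fin n → ℕ) → (∀ i → f i ≤ c) → sum f ≤ n * c
sum-≤-* {zero}  c f f≤c = z≤n
sum-≤-* {suc n} c f f≤c = +-mono-≤ (f≤c zero) (sum-≤-* c (f ∘ suc) (f≤c ∘ suc))

0<sum⇒∃0< : ∀ {n} (f : Fin n → ℕ) → 0 < sum f → ∃ λ i → 0 < f i
0<sum⇒∃0< {n} f 0<∑f with any? (λ i → 0 <? f i)
... | yes found = found
... | no none = contradiction (trans (sum-cong-≗ f≗0) (sum-replicate-zero n)) (<⇒≢ 0<∑f ∘ sym)
  where
  f≗0 : ∀ i → f i ≡ 0
  f≗0 i = n≤0⇒n≡0 (≮⇒≥ (λ 0<fi → none (i , 0<fi)))

module _ {n : ℕ} where

  lookup-≗⇒≡ : ∀ {u v : Multiset n} → lookup u ≗ lookup v → u ≡ v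
  lookup-≗⇒≡ {u} {v} u≗v = trans (sym (tabulate∘lookup u)) (trans (tabulate-cong u≗v) (tabulate∘lookup v))

  ⊆-from-lookup : ∀ {u v : Multiset n} → (∀ a → lookup u a ≤ lookup v a) → u ⊆ v
  ⊆-from-lookup {u} {v} u≤v =
    subst₂ (Pointwise.Pointwise _≤_) (tabulate∘lookup u) (tabulate∘lookup v) (Pointwise.tabulate⁺ u≤v)

  size : Multiset n → ℕ
  size m = sum (lookup m)

  lookup-θ : ∀ a → lookup (θ {n}) a ≡ 0
  lookup-θ a = lookup-replicate a 0

  lookup-⊕ : ∀ (u v : Multiset n) a → lookup (u ⊕ v) a ≡ lookup u a + lookup v a
  lookup-⊕ u v a = lookup-zipWith _+_ a u v

  lookup-⊖ : ∀ (u v : Multiset n) a → lookup (u ⊖ v) a ≡ lookup u a ∸ lookup v a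
  lookup-⊖ u v a = lookup-zipWith _∸_ a u v

  lookup-sing : ∀ (a b : Fin n) → lookup (sing a) b ≡ (if does (a ≟ᶠ b) then 1 else 0)
  lookup-sing a b = trans (lookup∘tabulate _ b) (cong (if_then 1 else 0) (isYes≗does (a ≟ᶠ b)))

  lookup-sing-≡ : ∀ (a : Fin n) → lookup (sing a) a ≡ 1
  lookup-sing-≡ a = trans (lookup-sing a a) (cong (if_then 1 else 0) (dec-true (a ≟ᶠ a) refl))

  lookup-sing-≢ : ∀ {a b : Fin n} → a ≢ b → lookup (sing a) b ≡ 0
  lookup-sing-≢ {a} {b} a≢b = trans (lookup-sing a b) (cong (if_then 1 else 0) (dec-false (a ≟ᶠ b) a≢b))

size-sing : ∀ {n} (a : Fin n) → size (sing a) ≡ 1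
size-sing {suc n} a = begin
  sum (lookup (sing a))                              ≡⟨ sum-remove {i = a} (lookup (sing a)) ⟩
  lookup (sing a) a + sum (lookup (sing a) ∘ punch)  ≡⟨ cong₂ _+_ (lookup-sing-≡ a) (sum-cong-≗ others) ⟩
  1 + sum {n} (λ _ → 0)                              ≡⟨ cong (1 +_) (sum-replicate-zero n) ⟩
  1                                                  ∎
  where
  open ≡-Reasoning
  punch = punchIn a
  others : ∀ j → lookup (sing a) (punch j) ≡ 0
  others j = lookup-sing-≢ (punchInᵢ≢i a j ∘ sym)

module _ {n : ℕ} where

  infix 4 _∈_
  _∈_ : Fin n → Multiset n → Set
  a ∈ m = 0 < lookup m a

  Bounded : ℕ → Multiset n → Set
  Bounded B m = ∀ a → lookup m a ≤ B

  size-⊕ : ∀ (u v : Multiset n) → size (u ⊕ v) ≡ size u + size v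
  size-⊕ u v = trans (sum-cong-≗ (lookup-⊕ u v)) (∑-distrib-+ (lookup u) (lookup v))

  size-sing-⊕ : ∀ a (m : Multiset n) → size (sing a ⊕ m) ≡ suc (size m)
  size-sing-⊕ a m = trans (size-⊕ (sing a) m) (cong (_+ size m) (size-sing a))

  size≡0⇒≡θ : ∀ {m : Multiset n} → size m ≡ 0 → m ≡ θ
  size≡0⇒≡θ {m} ∣m∣≡0 = lookup-≗⇒≡ λ a →
    trans (n≤0⇒n≡0 (subst (lookup m a ≤_) ∣m∣≡0 (≤-sum (lookup m) a))) (sym (lookup-θ a))

  [p⊕m]⊖p≡m : ∀ (p m : Multiset n) → (p ⊕ m) ⊖ p ≡ m
  [p⊕m]⊖p≡m p m = lookup-≗⇒≡ pointwise
    where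
    pointwise : ∀ a → lookup ((p ⊕ m) ⊖ p) a ≡ lookup m a
    pointwise a rewrite lookup-⊖ (p ⊕ m) p a | lookup-⊕ p m a = m+n∸m≡n (lookup p a) (lookup m a)

  p⊕[m⊖p]≡m : ∀ {p m : Multiset n} → p ⊆ m → p ⊕ (m ⊖ p) ≡ m
  p⊕[m⊖p]≡m {p} {m} p⊆m = lookup-≗⇒≡ pointwise
    where
    pointwise : ∀ a → lookup (p ⊕ (m ⊖ p)) a ≡ lookup m a
    pointwise a rewrite lookup-⊕ p (m ⊖ p) a | lookup-⊖ m p a = m+[n∸m]≡n (Pointwise.lookup p⊆m a)

  [q⊕m]⊖p≡q⊕[m⊖p] : ∀ (q : Multiset n) {p m} → p ⊆ m → (q ⊕ m) ⊖ p ≡ q ⊕ (m ⊖ p)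
  [q⊕m]⊖p≡q⊕[m⊖p] q {p} {m} p⊆m = lookup-≗⇒≡ pointwise
    where
    pointwise : ∀ a → lookup ((q ⊕ m) ⊖ p) a ≡ lookup (q ⊕ (m ⊖ p)) a
    pointwise a rewrite lookup-⊖ (q ⊕ m) p a | lookup-⊕ q m a | lookup-⊕ q (m ⊖ p) a | lookup-⊖ m p a =
      +-∸-assoc (lookup q a) (Pointwise.lookup p⊆m a)

  [m⊖p]⊖q≡[m⊖q]⊖p : ∀ (m p q : Multiset n) → (m ⊖ p) ⊖ q ≡ (m ⊖ q) ⊖ p
  [m⊖p]⊖q≡[m⊖q]⊖p m p q = lookup-≗⇒≡ pointwise
    where
    pointwise : ∀ a → lookup ((m ⊖ p) ⊖ q) a ≡ lookup ((m ⊖ q) ⊖ p) a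
    pointwise a rewrite lookup-⊖ (m ⊖ p) q a | lookup-⊖ m p a | lookup-⊖ (m ⊖ q) p a | lookup-⊖ m q a
                      | ∸-+-assoc (lookup m a) (lookup p a) (lookup q a)
                      | ∸-+-assoc (lookup m a) (lookup q a) (lookup p a) =
      cong (lookup m a ∸_) (+-comm (lookup p a) (lookup q a))

  ∈-⊖ : ∀ (m p : Multiset n) {a} → lookup p a < lookup m a → a ∈ m ⊖ p
  ∈-⊖ m p {a} p<m = subst (0 <_) (sym (lookup-⊖ m p a)) (m<n⇒0<n∸m p<m)

  m⊖p⊆m : ∀ (m p : Multiset n) → m ⊖ p ⊆ m
  m⊖p⊆m m p = ⊆-from-lookup λ a →
    subst (_≤ lookup m a) (sym (lookup-⊖ m p a)) (m∸n≤m (lookup m a) (lookup p a))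

  sing⊆ : ∀ {a} {m : Multiset n} → a ∈ m → sing a ⊆ m
  sing⊆ {a} {m} a∈m = ⊆-from-lookup pointwise
    where
    pointwise : ∀ b → lookup (sing a) b ≤ lookup m b
    pointwise b with a ≟ᶠ b
    ... | yes refl = subst (_≤ lookup m a) (sym (lookup-sing-≡ a)) a∈m
    ... | no a≢b   = subst (_≤ lookup m b) (sym (lookup-sing-≢ a≢b)) z≤n

  ⊆-⊖-sing : ∀ {p m : Multiset n} {a} → p ⊆ m → lookup p a < lookup m a → p ⊆ m ⊖ sing a
  ⊆-⊖-sing {p} {m} {a} p⊆m p<m = ⊆-from-lookup pointwise
    where
    pointwise : ∀ b → lookup p b ≤ lookup (m ⊖ sing a) b
    pointwise b rewrite lookup-⊖ m (sing a) b with a ≟ᶠ b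
    ... | yes refl rewrite lookup-sing-≡ a = <⇒≤pred p<m
    ... | no a≢b   rewrite lookup-sing-≢ a≢b = Pointwise.lookup p⊆m b

  InDom-⊖ : ∀ {s} (m p : Multiset n) → InDom s (m ⊖ p) → InDom s m
  InDom-⊖ {s} m p s∈m⊖p ms≡0 =
    s∈m⊖p (trans (lookup-⊖ m p s) (trans (cong (_∸ lookup p s) ms≡0) (0∸n≡0 (lookup p s))))

  InDom-⊖-sing : ∀ {s a} {m : Multiset n} → 1 < lookup m a → InDom s m → InDom s (m ⊖ sing a)
  InDom-⊖-sing {s} {a} {m} 1<ma s∈m rewrite lookup-⊖ m (sing a) s with a ≟ᶠ s
  ... | yes refl rewrite lookup-sing-≡ a = m>n⇒m∸n≢0 1<ma
  ... | no a≢s   rewrite lookup-sing-≢ a≢s = s∈m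

  size-⊖-sing : ∀ {a} {m : Multiset n} → a ∈ m → suc (size (m ⊖ sing a)) ≡ size m
  size-⊖-sing {a} {m} a∈m = begin
    suc (size (m ⊖ sing a))      ≡⟨ size-sing-⊕ a (m ⊖ sing a) ⟨
    size (sing a ⊕ (m ⊖ sing a)) ≡⟨ cong size (p⊕[m⊖p]≡m (sing⊆ a∈m)) ⟩
    size m                       ∎
    where open ≡-Reasoning

  ∀-bounded? : ∀ B {P : Multiset n → Set} → Decidable P → Dec (∀ m → Bounded B m → P m)
  ∀-bounded? B {P} P? = map′ on-bounded on-codes (∀? (exhaustible-Vec exhaustible-Fin n) (P? ∘ map toℕ))
    where
    on-bounded : (∀ (u : Vec (Fin (suc B)) n) → P (map toℕ u)) → ∀ m → Bounded B m → P m
    on-bounded all-codes m m≤B = subst P (lookup-≗⇒≡ decode) (all-codes code)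
      where
      code = tabulate (λ a → fromℕ< (s≤s (m≤B a)))
      decode : ∀ a → lookup (map toℕ code) a ≡ lookup m a
      decode a = trans (lookup-map a toℕ code) (trans (cong toℕ (lookup∘tabulate _ a)) (toℕ-fromℕ< _))
    on-codes : (∀ m → Bounded B m → P m) → ∀ (u : Vec (Fin (suc B)) n) → P (map toℕ u)
    on-codes all-bounded u = all-bounded (map toℕ u) λ a →
      subst (_≤ B) (sym (lookup-map a toℕ u)) (toℕ≤pred[n] (lookup u a))

Lift-mono : ∀ {n} {R R′ : PlaceRel n} → (∀ {a b} → R a b ≡ true → R′ a b ≡ true) →
            ∀ {x y} → Lift R x y → Lift R′ x y
Lift-mono R⇒R′ θθ         = θθ
Lift-mono R⇒R′ (step r d) = step (R⇒R′ r) (Lift-mono R⇒R′ d)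

module _ {n : ℕ} {R : PlaceRel n} where

  size-Lift : ∀ {x y} → Lift R x y → size x ≡ size y
  size-Lift θθ = refl
  size-Lift (step {s₁} {s₂} {m₁} {m₂} _ d) =
    trans (size-sing-⊕ s₁ m₁) (trans (cong suc (size-Lift d)) (sym (size-sing-⊕ s₂ m₂)))

  Lift-⊖-sing⁻ : ∀ {x y a b} → R a b ≡ true → a ∈ x → b ∈ y → Lift R (x ⊖ sing a) (y ⊖ sing b) → Lift R x y
  Lift-⊖-sing⁻ r a∈x b∈y d = subst₂ (Lift R) (p⊕[m⊖p]≡m (sing⊆ a∈x)) (p⊕[m⊖p]≡m (sing⊆ b∈y)) (step r d)

  pairCount : ∀ {x y} → Lift R x y → Fin n → Fin n → ℕ
  pairCount θθ                     a b = 0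
  pairCount (step {s₁} {s₂} _ d) a b = lookup (sing s₁) a * lookup (sing s₂) b + pairCount d a b

  sum-pairCountʳ : ∀ {x y} (d : Lift R x y) a → sum (pairCount d a) ≡ lookup x a
  sum-pairCountʳ θθ a = trans (sum-replicate-zero n) (sym (lookup-θ a))
  sum-pairCountʳ (step {s₁} {s₂} {m₁} _ d) a = begin
    sum (λ b → lookup (sing s₁) a * lookup (sing s₂) b + pairCount d a b)
      ≡⟨ ∑-distrib-+ (λ b → lookup (sing s₁) a * lookup (sing s₂) b) (pairCount d a) ⟩
    sum (λ b → lookup (sing s₁) a * lookup (sing s₂) b) + sum (pairCount d a)
      ≡⟨ cong₂ _+_ (sym (*-distribˡ-sum (lookup (sing s₁) a) (lookup (sing s₂)))) (sum-pairCountʳ d a) ⟩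
    lookup (sing s₁) a * sum (lookup (sing s₂)) + lookup m₁ a
      ≡⟨ cong (λ k → lookup (sing s₁) a * k + lookup m₁ a) (size-sing s₂) ⟩
    lookup (sing s₁) a * 1 + lookup m₁ a
      ≡⟨ cong (_+ lookup m₁ a) (*-identityʳ _) ⟩
    lookup (sing s₁) a + lookup m₁ a
      ≡⟨ lookup-⊕ (sing s₁) m₁ a ⟨
    lookup (sing s₁ ⊕ m₁) a
      ∎
    where open ≡-Reasoning

  sum-pairCountˡ : ∀ {x y} (d : Lift R x y) b → sum (λ a → pairCount d a b) ≡ lookup y b
  sum-pairCountˡ θθ b = trans (sum-replicate-zero n) (sym (lookup-θ b))
  sum-pairCountˡ (step {s₁} {s₂} {m₁} {m₂} _ d) b = begin
    sum (λ a → lookup (sing s₁) a * lookup (sing s₂) b + pairCount d a b)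
      ≡⟨ ∑-distrib-+ (λ a → lookup (sing s₁) a * lookup (sing s₂) b) (λ a → pairCount d a b) ⟩
    sum (λ a → lookup (sing s₁) a * lookup (sing s₂) b) + sum (λ a → pairCount d a b)
      ≡⟨ cong₂ _+_ (sym (*-distribʳ-sum (lookup (sing s₂) b) (lookup (sing s₁)))) (sum-pairCountˡ d b) ⟩
    sum (lookup (sing s₁)) * lookup (sing s₂) b + lookup m₂ b
      ≡⟨ cong (λ k → k * lookup (sing s₂) b + lookup m₂ b) (size-sing s₁) ⟩
    1 * lookup (sing s₂) b + lookup m₂ b
      ≡⟨ cong (_+ lookup m₂ b) (*-identityˡ _) ⟩
    lookup (sing s₂) b + lookup m₂ b
      ≡⟨ lookup-⊕ (sing s₂) m₂ b ⟨
    lookup (sing s₂ ⊕ m₂) b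
      ∎
    where open ≡-Reasoning

  pairCount≤ˡ : ∀ {x y} (d : Lift R x y) a b → pairCount d a b ≤ lookup x a
  pairCount≤ˡ d a b = subst (pairCount d a b ≤_) (sum-pairCountʳ d a) (≤-sum (pairCount d a) b)

  pairCount≤ʳ : ∀ {x y} (d : Lift R x y) a b → pairCount d a b ≤ lookup y b
  pairCount≤ʳ d a b = subst (pairCount d a b ≤_) (sum-pairCountˡ d b) (≤-sum (λ a → pairCount d a b) a)

  head-pair≡0 : ∀ {s₁ s₂ a b : Fin n} → ¬ (s₁ ≡ a × s₂ ≡ b) → lookup (sing s₁) a * lookup (sing s₂) b ≡ 0
  head-pair≡0 {s₁} {s₂} {a} {b} other with s₁ ≟ᶠ a
  ... | no s₁≢a  rewrite lookup-sing-≢ s₁≢a = refl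
  ... | yes refl rewrite lookup-sing-≢ (λ s₂≡b → other (refl , s₂≡b)) = *-zeroʳ (lookup (sing a) a)

  Lift-remove-pair : ∀ {x y a b} (d : Lift R x y) → 0 < pairCount d a b →
                     R a b ≡ true × Lift R (x ⊖ sing a) (y ⊖ sing b)
  Lift-remove-pair {a = a} {b} (step {s₁} {s₂} {m₁} {m₂} r d) used with (s₁ ≟ᶠ a) ×-dec (s₂ ≟ᶠ b)
  ... | yes (refl , refl) = r , subst₂ (Lift R) (sym ([p⊕m]⊖p≡m (sing a) m₁)) (sym ([p⊕m]⊖p≡m (sing b) m₂)) d
  ... | no other =
    let r′ , d′ = Lift-remove-pair d used′ in
    r′ , subst₂ (Lift R) (sym ([q⊕m]⊖p≡q⊕[m⊖p] (sing s₁) (sing⊆ a∈m₁)))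
                         (sym ([q⊕m]⊖p≡q⊕[m⊖p] (sing s₂) (sing⊆ b∈m₂))) (step r d′)
    where
    used′ : 0 < pairCount d a b
    used′ = subst (λ k → 0 < k + pairCount d a b) (head-pair≡0 other) used
    a∈m₁ = ≤-trans used′ (pairCount≤ˡ d a b)
    b∈m₂ = ≤-trans used′ (pairCount≤ʳ d a b)

  Lift-⊖-sing : ∀ {x y a} → Lift R x y → a ∈ x →
                ∃ λ b → R a b ≡ true × b ∈ y × Lift R (x ⊖ sing a) (y ⊖ sing b)
  Lift-⊖-sing {a = a} d a∈x with 0<sum⇒∃0< (pairCount d a) (subst (0 <_) (sym (sum-pairCountʳ d a)) a∈x)
  ... | b , used with Lift-remove-pair d used
  ...   | r , d′ = b , r , ≤-trans used (pairCount≤ʳ d a b) , d′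

  lift?-of-size : ∀ k x y → size x ≡ k → Dec (Lift R x y)
  lift?-of-size zero x y ∣x∣≡0 =
    map′ (λ { refl → subst (λ x → Lift R x θ) (sym (size≡0⇒≡θ ∣x∣≡0)) θθ })
         (λ d → size≡0⇒≡θ (trans (sym (size-Lift d)) ∣x∣≡0))
         (≡-dec _≟_ y θ)
  lift?-of-size (suc k) x y ∣x∣≡1+k with 0<sum⇒∃0< (lookup x) (subst (0 <_) (sym ∣x∣≡1+k) (s≤s z≤n))
  ... | a , a∈x =
    map′ (λ (b , r , b∈y , d) → Lift-⊖-sing⁻ r a∈x b∈y d) (λ d → Lift-⊖-sing d a∈x)
         (any? λ b → (R a b ≟ᵇ true) ×-dec (0 <? lookup y b) ×-dec lift?-of-size k _ _ smaller)
    where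
    smaller : size (x ⊖ sing a) ≡ k
    smaller = suc-injective (trans (size-⊖-sing {m = x} a∈x) ∣x∣≡1+k)

  lift? : ∀ x y → Dec (Lift R x y)
  lift? x y = lift?-of-size (size x) x y refl

  Lift-dense-or-bounded : ∀ c {x y} (d : Lift R x y) →
    (∃₂ λ a b → c ≤ pairCount d a b) ⊎ (Bounded (n * c) x × Bounded (n * c) y)
  Lift-dense-or-bounded c {x} {y} d with any? (λ a → any? (λ b → c ≤? pairCount d a b))
  ... | yes dense = inj₁ dense
  ... | no sparse = inj₂ (x≤ , y≤)
    where
    count≤c : ∀ a b → pairCount d a b ≤ c
    count≤c a b = <⇒≤ (≰⇒> (λ c≤ → sparse (a , b , c≤)))
    x≤ : Bounded (n * c) x
    x≤ a = subst (_≤ n * c) (sum-pairCountʳ d a) (sum-≤-* c (pairCount d a) (count≤c a))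
    y≤ : Bounded (n * c) y
    y≤ b = subst (_≤ n * c) (sum-pairCountˡ d b) (sum-≤-* c (λ a → pairCount d a b) (λ a → count≤c a b))

module _ {n k : ℕ} (N : PTINet n k) where
  open PTINet N

  enabled? : ∀ i m → Dec (Enabled N i m)
  enabled? i m = Pointwise.decidable _≤?_ (pre i) m
           ×-dec all? (λ s → (inh s i ≟ᵇ true) →-dec ¬? (¬? (lookup m s ≟ 0)))

  Enabled-⊖ : ∀ {i m} p → Enabled N i m → pre i ⊆ m ⊖ p → Enabled N i (m ⊖ p)
  Enabled-⊖ {m = m} p (_ , uninhibited) pre⊆ =
    pre⊆ , λ s s∈°i s∈m⊖p → uninhibited s s∈°i (InDom-⊖ m p s∈m⊖p)

  Enabled-⊖⁻ : ∀ {i m} p → Enabled N i (m ⊖ p) → (∀ s → InDom s m → InDom s (m ⊖ p)) → Enabled N i m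
  Enabled-⊖⁻ {m = m} p (pre⊆ , uninhibited) dom⊆ =
    Pointwise.trans ≤-trans pre⊆ (m⊖p⊆m m p) , λ s s∈°i s∈m → uninhibited s s∈°i (dom⊆ s s∈m)

  threshold : ℕ
  threshold = 2 + sum (λ i → size (pre i))

  bound : ℕ
  bound = n * threshold

  Abundant : Multiset n → Fin n → Set
  Abundant m a = ∀ i → 2 + lookup (pre i) a ≤ lookup m a

  threshold≤⇒Abundant : ∀ {m a} → threshold ≤ lookup m a → Abundant m a
  threshold≤⇒Abundant {a = a} t≤m i =
    ≤-trans (+-monoʳ-≤ 2 (≤-trans (≤-sum (lookup (pre i)) a) (≤-sum (λ i → size (pre i)) i))) t≤m

  module _ (R : PlaceRel n) where

    Transfer : Multiset n → Multiset n → Set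
    Transfer m₁ m₂ =
        (∀ t₁ → Enabled N t₁ m₁ → ∃ λ t₂ → Enabled N t₂ m₂ × Match N R m₁ m₂ t₁ t₂)
      × (∀ t₂ → Enabled N t₂ m₂ → ∃ λ t₁ → Enabled N t₁ m₁ × Match N R m₁ m₂ t₁ t₂)

    match? : ∀ m₁ m₂ t₁ t₂ → Dec (Match N R m₁ m₂ t₁ t₂)
    match? m₁ m₂ t₁ t₂ =
      (lift? (pre t₁) (pre t₂) ×-dec lift? (post t₁) (post t₂) ×-dec (lab t₁ ≟ᶠ lab t₂)
        ×-dec lift? (m₁ ⊖ pre t₁) (m₂ ⊖ pre t₂))
      ×-dec all? λ s → all? λ s′ → (R s s′ ≟ᵇ true) →-dec
              (((inh s t₁ ≟ᵇ true) →-dec (inh s′ t₂ ≟ᵇ true))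
                ×-dec ((inh s′ t₂ ≟ᵇ true) →-dec (inh s t₁ ≟ᵇ true)))

    transfer? : ∀ m₁ m₂ → Dec (Transfer m₁ m₂)
    transfer? m₁ m₂ =
          all? (λ t₁ → enabled? t₁ m₁ →-dec any? (λ t₂ → enabled? t₂ m₂ ×-dec match? m₁ m₂ t₁ t₂))
      ×-dec all? (λ t₂ → enabled? t₂ m₂ →-dec any? (λ t₁ → enabled? t₁ m₁ ×-dec match? m₁ m₂ t₁ t₂))

    Match-⊖-sing⁻ : ∀ {m₁ m₂ a b t₁ t₂} → R a b ≡ true →
      lookup (pre t₁) a < lookup m₁ a → lookup (pre t₂) b < lookup m₂ b →
      Match N R (m₁ ⊖ sing a) (m₂ ⊖ sing b) t₁ t₂ → Match N R m₁ m₂ t₁ t₂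
    Match-⊖-sing⁻ {m₁} {m₂} {a} {b} {t₁} {t₂} r pre<m₁ pre<m₂ ((pres , posts , labs , rests) , inhibitors) =
      (pres , posts , labs , Lift-⊖-sing⁻ r (∈-⊖ m₁ (pre t₁) pre<m₁) (∈-⊖ m₂ (pre t₂) pre<m₂) swapped) ,
      inhibitors
      where
      swapped = subst₂ (Lift R) ([m⊖p]⊖q≡[m⊖q]⊖p m₁ (sing a) (pre t₁))
                                ([m⊖p]⊖q≡[m⊖q]⊖p m₂ (sing b) (pre t₂)) rests

    Transfer-⊖-sing⁻ : ∀ {m₁ m₂ a b} → R a b ≡ true → Abundant m₁ a → Abundant m₂ b →
      Transfer (m₁ ⊖ sing a) (m₂ ⊖ sing b) → Transfer m₁ m₂
    Transfer-⊖-sing⁻ {m₁} {m₂} {a} {b} r ab₁ ab₂ (forth , back) = forth′ , back′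
      where
      pre< : ∀ {m c} → Abundant m c → ∀ i → lookup (pre i) c < lookup m c
      pre< ab i = ≤-trans (n≤1+n _) (ab i)
      down : ∀ m c → Abundant m c → ∀ i → Enabled N i m → Enabled N i (m ⊖ sing c)
      down m c ab i en = Enabled-⊖ (sing c) en (⊆-⊖-sing (proj₁ en) (pre< {m} ab i))
      up : ∀ m c → Abundant m c → ∀ i → Enabled N i (m ⊖ sing c) → Enabled N i m
      up m c ab i en = Enabled-⊖⁻ (sing c) en (λ _ → InDom-⊖-sing {m = m} (≤-trans (s≤s (s≤s z≤n)) (ab i)))
      match : ∀ {t₁ t₂} → Match N R (m₁ ⊖ sing a) (m₂ ⊖ sing b) t₁ t₂ → Match N R m₁ m₂ t₁ t₂
      match {t₁} {t₂} = Match-⊖-sing⁻ r (pre< {m₁} ab₁ t₁) (pre< {m₂} ab₂ t₂)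
      forth′ : ∀ t₁ → Enabled N t₁ m₁ → ∃ λ t₂ → Enabled N t₂ m₂ × Match N R m₁ m₂ t₁ t₂
      forth′ t₁ en with forth t₁ (down m₁ a ab₁ t₁ en)
      ... | t₂ , en₂ , matched = t₂ , up m₂ b ab₂ t₂ en₂ , match matched
      back′ : ∀ t₂ → Enabled N t₂ m₂ → ∃ λ t₁ → Enabled N t₁ m₁ × Match N R m₁ m₂ t₁ t₂
      back′ t₂ en with back t₂ (down m₂ b ab₂ t₂ en)
      ... | t₁ , en₁ , matched = t₁ , up m₁ a ab₁ t₁ en₁ , match matched

    IsPtiPlaceBisim-from-bounded :
      (∀ m₁ → Bounded bound m₁ → ∀ m₂ → Bounded bound m₂ → Lift R m₁ m₂ → Transfer m₁ m₂) →
      IsPtiPlaceBisim N R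
    IsPtiPlaceBisim-from-bounded bounded m₁ m₂ = go (<-wellFounded (size m₁))
      where
      go : ∀ {m₁ m₂} → Acc _<_ (size m₁) → Lift R m₁ m₂ → Transfer m₁ m₂
      go {m₁} {m₂} (acc smaller) d with Lift-dense-or-bounded threshold d
      ... | inj₂ (m₁≤ , m₂≤) = bounded m₁ m₁≤ m₂ m₂≤ d
      ... | inj₁ (a , b , dense) with Lift-remove-pair d (≤-trans (s≤s z≤n) dense)
      ...   | r , d′ = Transfer-⊖-sing⁻ r (threshold≤⇒Abundant {m₁} dense₁) (threshold≤⇒Abundant {m₂} dense₂)
                                       (go (smaller shrinks) d′)
        where
        dense₁ = ≤-trans dense (pairCount≤ˡ d a b)
        dense₂ = ≤-trans dense (pairCount≤ʳ d a b)
        shrinks : size (m₁ ⊖ sing a) < size m₁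
        shrinks = ≤-reflexive (size-⊖-sing {m = m₁} (≤-trans (s≤s z≤n) dense₁))

    isPtiPlaceBisim? : Dec (IsPtiPlaceBisim N R)
    isPtiPlaceBisim? =
      map′ IsPtiPlaceBisim-from-bounded (λ bisim m₁ _ m₂ _ → bisim m₁ m₂)
           (∀-bounded? bound λ m₁ → ∀-bounded? bound λ m₂ → lift? m₁ m₂ →-dec transfer? m₁ m₂)

module _ {n k : ℕ} (N : PTINet n k) {R R′ : PlaceRel n} (R≗R′ : ∀ a b → R a b ≡ R′ a b) where

  Match-cong : ∀ {m₁ m₂ t₁ t₂} → Match N R m₁ m₂ t₁ t₂ → Match N R′ m₁ m₂ t₁ t₂
  Match-cong ((pres , posts , labs , rests) , inhibitors) =
    (Lift-mono R⇒R′ pres , Lift-mono R⇒R′ posts , labs , Lift-mono R⇒R′ rests) ,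
    λ s s′ r′ → inhibitors s s′ (trans (R≗R′ s s′) r′)
    where
    R⇒R′ : ∀ {a b} → R a b ≡ true → R′ a b ≡ true
    R⇒R′ {a} {b} = trans (sym (R≗R′ a b))

  IsPtiPlaceBisim-cong : IsPtiPlaceBisim N R → IsPtiPlaceBisim N R′
  IsPtiPlaceBisim-cong bisim m₁ m₂ d with bisim m₁ m₂ (Lift-mono (trans (R≗R′ _ _)) d)
  ... | forth , back =
    (λ t₁ en → let (t₂ , en₂ , matched) = forth t₁ en in t₂ , en₂ , Match-cong matched) ,
    (λ t₂ en → let (t₁ , en₁ , matched) = back t₂ en in t₁ , en₁ , Match-cong matched)

theorem30 : {n k : ℕ} (N : PTINet n k) (m₁ m₂ : Multiset n) →
            Dec (PtiPlaceBisimilar N m₁ m₂)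
theorem30 {n} N m₁ m₂ =
  map′ (λ (M , bisim , m₁∼m₂) → relation M , bisim , m₁∼m₂)
       (λ (R , bisim , m₁∼m₂) → matrix R ,
          IsPtiPlaceBisim-cong N (relation-matrix R) bisim ,
          Lift-mono (λ {a} {b} → trans (sym (relation-matrix R a b))) m₁∼m₂)
       (exhaustible-Vec (exhaustible-Vec exhaustible-Bool n) n λ M →
          isPtiPlaceBisim? N (relation M) ×-dec lift? {R = relation M} m₁ m₂)
  where
  relation : Vec (Vec Bool n) n → PlaceRel n
  relation M a b = lookup (lookup M a) b
  matrix : PlaceRel n → Vec (Vec Bool n) n
  matrix R = tabulate (tabulate ∘ R)
  relation-matrix : ∀ R a b → R a b ≡ relation (matrix R) a b
  relation-matrix R a b =
    sym (trans (cong (λ row → lookup row b) (lookup∘tabulate _ a)) (lookup∘tabulate (R a) b))
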